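{- Let $H$ be a graph with at least one edge and no isolated edges, and suppose $k_0 = k_1 < k_1' < k_0'$. Then for every $n \geq |H|$, \[ \operatorname{sat}(n, H) \geq \begin{cases} \big( k_0 + \frac{k_0' - k_0}{k_0' + 1} \big) \frac{n}{2} - c_1 & \text{if } k_0' \leq k_1' + \frac{k_0' - k_0}{k_0 + 1}; \\ \big( k_0 + \frac{k_1' - k_0}{k_1'} \big) \frac{n}{2} - c_2 & \text{if } k_0' \geq k_1' + \frac{k_0' - k_0}{k_0 + 1}, \end{cases} \] where $c_1 = \frac{(k_0 + 1)(k_0' - k_0)}{2k_0' + 2} + \frac{(k_0 + 1)^2}{8}$ and $c_2 = \frac{(k_0 + 2)(k_1' - k_0)}{2k_1'} + \frac{(k_0 + 1)^2}{8}$.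
   Context: Graphs are finite and simple; $|G|$ denotes the number of vertices. A graph $G$ is $H$-saturated if $G$ contains no subgraph isomorphic to $H$ but adding any edge joining two nonadjacent vertices of $G$ creates such a subgraph. $\operatorname{sat}(n,H)$ is the minimum number of edges of an $H$-saturated graph on $n$ vertices. For an edge $uv$ of $H$, let $N(uv) = (N(u)\setminus\{v\}) \cup (N(v)\setminus\{u\})$; the edge is isolated if $N(uv)=\varnothing$. Degrees are taken in $H$. Define $\mathrm{wt}_0(uv) = \max\{d(u),d(v)\} - 1$ and, for non-isolated $uv$, $\mathrm{wt}_1(uv) = \max_{w \in N(uv)} d(w)$. Let $k_0 = \min_{uv\in E(H)} \mathrm{wt}_0(uv)$, $k_1 = \min_{uv \in E(H)} \mathrm{wt}_1(uv)$, $k_0' = \min\{\mathrm{wt}_0(uv) : uv \in E(H),\ \mathrm{wt}_1(uv) = k_1\}$, and $k_1' = \min\{\mathrm{wt}_1(uv) : uv \in E(H),\ \mathrm{wt}_0(uv) = k_0\}$. -}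

module Defs where

open import Data.Nat as ℕ using (ℕ; zero; suc; _⊔_; _∸_)
open import Data.Integer as ℤ using (ℤ; +_)
open import Data.Rational as Q using (ℚ)
open import Data.Bool using (Bool; true; false; _∧_; _∨_; not; if_then_else_)
open import Data.Fin using (Fin; _≟_; _<?_) renaming (zero to fzero; suc to fsuc)
open import Data.Product using (Σ; ∃; _×_; _,_)
open import Relation.Nullary using (¬_)
open import Relation.Nullary.Decidable using (⌊_⌋)
open import Relation.Binary.PropositionalEquality using (_≡_; _≢_)
open import Function.Definitions using (Injective)
open import Data.Unit using () renaming (⊤ to ⊤')

record Graph (n : ℕ) : Set where
  field
    adj    : Fin n → Fin n → Bool
    sym    : ∀ i j → adj i j ≡ adj j i
    irrefl : ∀ i → adj i i ≡ false
open Graph public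

count : ∀ {n} → (Fin n → Bool) → ℕ
count {zero}  p = 0
count {suc n} p = (if p fzero then 1 else 0) ℕ.+ count (λ x → p (fsuc x))

-- maximum of f over x : Fin n with p x ≡ true (0 if there is no such x)
maxOver : ∀ {n} → (Fin n → Bool) → (Fin n → ℕ) → ℕ
maxOver {zero}  p f = 0
maxOver {suc n} p f =
  (if p fzero then f fzero else 0) ⊔ maxOver (λ x → p (fsuc x)) (λ x → f (fsuc x))

numEdges : ∀ {n} → Graph n → ℕ
numEdges G = count' (adj G)
  where
  count' : ∀ {n} → (Fin n → Fin n → Bool) → ℕ
  count' {n} a = sumFin (λ i → count (λ j → ⌊ i <? j ⌋ ∧ a i j))
    where
    sumFin : ∀ {m} → (Fin m → ℕ) → ℕ
    sumFin {zero}  f = 0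
    sumFin {suc m} f = f fzero ℕ.+ sumFin (λ x → f (fsuc x))

Contains : ∀ {h n} → Graph h → (Fin n → Fin n → Bool) → Set
Contains {h} {n} H a =
  Σ (Fin h → Fin n) λ f → Injective _≡_ _≡_ f ×
    (∀ i j → adj H i j ≡ true → a (f i) (f j) ≡ true)

addEdge : ∀ {n} → Graph n → Fin n → Fin n → (Fin n → Fin n → Bool)
addEdge G u v i j =
  adj G i j ∨ (⌊ i ≟ u ⌋ ∧ ⌊ j ≟ v ⌋) ∨ (⌊ i ≟ v ⌋ ∧ ⌊ j ≟ u ⌋)

Saturated : ∀ {h n} → Graph h → Graph n → Set
Saturated H G =
  ¬ Contains H (adj G) ×
  (∀ u v → u ≢ v → adj G u v ≡ false → Contains H (addEdge G u v))

module _ {h : ℕ} (H : Graph h) where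

  deg : Fin h → ℕ
  deg u = count (adj H u)

  inN : Fin h → Fin h → Fin h → Bool
  inN u v w = (adj H u w ∧ not ⌊ w ≟ v ⌋) ∨ (adj H v w ∧ not ⌊ w ≟ u ⌋)

  IsolatedEdge : Fin h → Fin h → Set
  IsolatedEdge u v = adj H u v ≡ true × (∀ w → inN u v w ≡ false)

  HasEdge : Set
  HasEdge = ∃ λ u → ∃ λ v → adj H u v ≡ true

  NoIsolatedEdges : Set
  NoIsolatedEdges = ∀ u v → ¬ IsolatedEdge u v

  wt0 : Fin h → Fin h → ℕ
  wt0 u v = (deg u ⊔ deg v) ∸ 1

  -- max_{w ∈ N(uv)} d(w)  (only used for non-isolated edges)
  wt1 : Fin h → Fin h → ℕ
  wt1 u v = maxOver (inN u v) deg

  IsMinOverEdges : (Fin h → Fin h → Set) → (Fin h → Fin h → ℕ) → ℕ → Set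
  IsMinOverEdges P wt k =
    (∃ λ u → ∃ λ v → adj H u v ≡ true × P u v × wt u v ≡ k) ×
    (∀ u v → adj H u v ≡ true → P u v → k ℕ.≤ wt u v)

  IsK0 : ℕ → Set
  IsK0 = IsMinOverEdges (λ _ _ → ⊤') wt0

  IsK1 : ℕ → Set
  IsK1 = IsMinOverEdges (λ _ _ → ⊤') wt1

  IsK0' : ℕ → ℕ → Set
  IsK0' k1 = IsMinOverEdges (λ u v → wt1 u v ≡ k1) wt0

  IsK1' : ℕ → ℕ → Set
  IsK1' k0 = IsMinOverEdges (λ u v → wt0 u v ≡ k0) wt1

⟦_⟧ : ℕ → ℚ
⟦ m ⟧ = + m Q./ 1

-- a / d for a rational a and natural d (d = 0 never occurs below; value 0 then)
_÷ℕ_ : ℚ → ℕ → ℚ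
a ÷ℕ zero  = Q.0ℚ
a ÷ℕ suc d = a Q.* (+ 1 Q./ suc d)

module Bound (k0 k0' k1' n : ℕ) where
  open Q using (_+_; _-_; _*_)
  K0 K0' K1' N : ℚ
  K0 = ⟦ k0 ⟧ ; K0' = ⟦ k0' ⟧ ; K1' = ⟦ k1' ⟧ ; N = ⟦ n ⟧

  threshold : ℚ
  threshold = K1' + ((K0' - K0) ÷ℕ (k0 ℕ.+ 1))

  c1 c2 : ℚ
  c1 = (((K0 + ⟦ 1 ⟧) * (K0' - K0)) ÷ℕ (2 ℕ.* k0' ℕ.+ 2))
       + (((K0 + ⟦ 1 ⟧) * (K0 + ⟦ 1 ⟧)) ÷ℕ 8)
  c2 = (((K0 + ⟦ 2 ⟧) * (K1' - K0)) ÷ℕ (2 ℕ.* k1'))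
       + (((K0 + ⟦ 1 ⟧) * (K0 + ⟦ 1 ⟧)) ÷ℕ 8)

  bound1 bound2 : ℚ
  bound1 = (K0 + ((K0' - K0) ÷ℕ (k0' ℕ.+ 1))) * (N ÷ℕ 2) - c1
  bound2 = (K0 + ((K1' - K0) ÷ℕ k1')) * (N ÷ℕ 2) - c2

{-# OPTIONS --safe #-}
module Submission where

-- Adding a non-edge xy creates a copy of H in which xy is the image of an
-- edge uv, and comparing degrees gives wt0(uv) ≤ max(d x, d y) and, when N(uv) ≠ ∅, a neighbour z
-- of x or y with wt1(uv) ≤ d z. Consequently the vertices of degree < k0 form a clique, the low
-- vertices (degree ≤ k0) without high neighbours (degree ≥ k1') form a clique, and at most one high
-- vertex of degree < k0' has only low neighbours; these last two sets have at most k0 + 1 vertices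
-- together. Now discharge: every vertex starts with charge q·d(v), and every low–high edge moves p
-- from its high to its low end. Afterwards every vertex holds at least q·k0 + p, except for a deficit
-- q·(k0 − d v) at vertices of degree < k0 and p at the exceptional low and high vertices. By the
-- clique bounds and AM–GM the total deficit is at most q(k0 + 1)²/4 + p(k0 + 1), whence
-- 2q·e(G) ≥ n(q·k0 + p) − q(k0 + 1)²/4 − p(k0 + 1). The two bounds come from
-- (p, q) = (k0' − k0, k0' + 1) and (k1' − k0, k1'); the discharging needs p ≤ q together with
-- q·k0 + p·(k0' + 1) ≤ q·k0' and q·k0 + p·k1' ≤ q·k1', which hold on the respective side of the
-- threshold.

open import Defs
open import Data.Nat using (ℕ; _≤_; _<_)
open import Data.Rational using (ℚ) renaming (_≤_ to _≤ℚ_)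
open import Data.Product using (_×_)
open import Relation.Binary.PropositionalEquality using (_≡_)

open import Data.Bool using (Bool; true; false; _∧_; not; if_then_else_) renaming (_≟_ to _≟ᵇ_)
open import Data.Bool.Properties using (∧-conicalˡ; ∧-conicalʳ; ∧-zeroʳ; ∧-identityʳ; not-injective; ¬-not)
open import Data.Empty using (⊥-elim)
open import Data.Fin using (Fin; zero; suc) renaming (_≟_ to _≟ᶠ_; _<?_ to _<ᶠ?_)
import Data.Fin.Properties as Fin
import Data.Integer as ℤ
import Data.Integer.Properties as ℤₚ
open import Data.Nat using (zero; suc; _+_; _*_; _∸_; _⊔_; z≤n; s≤s; _≤?_; _<?_)
open import Data.Nat.Properties
open import Algebra.Properties.Semiring.Sum +-*-semiring
  using (sum; sum-cong-≗; ∑-distrib-+; ∑-comm; *-distribˡ-sum)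
open import Data.Nat.Tactic.RingSolver using (solve-∀)
open import Data.Product using (∃; ∃₂; _,_; proj₁; proj₂)
import Data.Rational as ℚ
import Data.Rational.Properties as ℚₚ
import Data.Rational.Solver as ℚ-Solver
open import Data.Rational.Unnormalised as ℚᵘ using (ℚᵘ; mkℚᵘ; *≡*; *≤*)
import Data.Rational.Unnormalised.Properties as ℚᵘₚ
open import Data.Sum using (_⊎_; inj₁; inj₂; [_,_]′)
open import Data.Unit using (tt)
open import Function using (_∘_; _$_)
open import Function.Definitions using (Injective)
open import Relation.Binary.Definitions using (tri<; tri≈; tri>)
open import Relation.Binary.PropositionalEquality
  using (_≢_; _≗_; refl; trans; cong; cong₂; subst; subst₂; module ≡-Reasoning)
import Relation.Binary.PropositionalEquality as ≡
open import Relation.Nullary using (¬_; yes; no; Dec)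
open import Relation.Nullary.Decidable using (⌊_⌋; ⌊⌋-map′; _×-dec_)

false≢true : false ≢ true
false≢true ()

⌊⌋-true : ∀ {A : Set} (a? : Dec A) → A → ⌊ a? ⌋ ≡ true
⌊⌋-true (yes _) _ = refl
⌊⌋-true (no ¬a) a = ⊥-elim (¬a a)

⌊⌋-true⁻¹ : ∀ {A : Set} (a? : Dec A) → ⌊ a? ⌋ ≡ true → A
⌊⌋-true⁻¹ (yes a) _ = a

⌊⌋-false⁻¹ : ∀ {A : Set} (a? : Dec A) → ⌊ a? ⌋ ≡ false → ¬ A
⌊⌋-false⁻¹ (no ¬a) _ = ¬a

∧-rotate : ∀ a b c → a ∧ (b ∧ c) ≡ c ∧ (b ∧ a)
∧-rotate true  b true  = refl
∧-rotate true  b false = ∧-zeroʳ b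
∧-rotate false b true  = ≡.sym (∧-zeroʳ b)
∧-rotate false b false = refl

-- Counting over Fin

iverson : Bool → ℕ
iverson b = if b then 1 else 0

iverson-mono : ∀ {a b} → (a ≡ true → b ≡ true) → iverson a ≤ iverson b
iverson-mono {false} _ = z≤n
iverson-mono {true}  h rewrite h refl = ≤-refl

_∖_ : ∀ {n} → (Fin n → Bool) → Fin n → Fin n → Bool
(p ∖ a) x = p x ∧ not ⌊ x ≟ᶠ a ⌋

∖⇒ : ∀ {n} (p : Fin n → Bool) {a x} → (p ∖ a) x ≡ true → p x ≡ true × x ≢ a
∖⇒ p {a} {x} e with x ≟ᶠ a
... | no x≢a = ∧-conicalˡ (p x) true e , x≢a
... | yes _  = ⊥-elim (false≢true (trans (≡.sym (∧-zeroʳ (p x))) e))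

count≡sum : ∀ {n} (p : Fin n → Bool) → count p ≡ sum (iverson ∘ p)
count≡sum {zero}  p = refl
count≡sum {suc n} p = cong (iverson (p zero) +_) (count≡sum (p ∘ suc))

count-cong : ∀ {n} {p q : Fin n → Bool} → p ≗ q → count p ≡ count q
count-cong {zero}  e = refl
count-cong {suc n} e = cong₂ _+_ (cong iverson (e zero)) (count-cong (e ∘ suc))

count-mono : ∀ {n} {p q : Fin n → Bool} → (∀ x → p x ≡ true → q x ≡ true) → count p ≤ count q
count-mono {zero}  h = z≤n
count-mono {suc n} h = +-mono-≤ (iverson-mono (h zero)) (count-mono (h ∘ suc))

count-false : ∀ {n} → count {n} (λ _ → false) ≡ 0
count-false {zero}  = refl
count-false {suc n} = count-false {n}

count-∧ˡ : ∀ {n} b (p : Fin n → Bool) → count (λ x → b ∧ p x) ≡ (if b then count p else 0)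
count-∧ˡ     true  p = refl
count-∧ˡ {n} false p = count-false {n}

count-split : ∀ {n} (c p : Fin n → Bool) →
  count p ≡ count (λ x → c x ∧ p x) + count (λ x → not (c x) ∧ p x)
count-split {zero}  c p = refl
count-split {suc n} c p rewrite count-split (c ∘ suc) (p ∘ suc) with c zero | p zero
... | true  | true  = refl
... | true  | false = refl
... | false | false = refl
... | false | true  = ≡.sym (+-suc _ _)

count-∖ : ∀ {n} (p : Fin n → Bool) {a} → p a ≡ true → count p ≡ suc (count (p ∖ a))
count-∖ {suc n} p {zero} pa rewrite pa =
  cong suc (count-cong (λ x → ≡.sym (∧-identityʳ (p (suc x)))))
count-∖ {suc n} p {suc a} pa rewrite ∧-identityʳ (p zero) | count-∖ (p ∘ suc) pa =
  trans (+-suc (iverson (p zero)) _)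
        (cong (λ c → suc (iverson (p zero) + c))
              (count-cong (λ x → cong (λ b → p (suc x) ∧ not b)
                                      (≡.sym (⌊⌋-map′ (cong suc) Fin.suc-injective (x ≟ᶠ a))))))

count-mono-except : ∀ {n} {p q : Fin n → Bool} {a} → p a ≡ true →
  (∀ x → p x ≡ true → x ≢ a → q x ≡ true) → count p ≤ suc (count q)
count-mono-except {p = p} {q} {a} pa h = begin
  count p             ≡⟨ count-∖ p pa ⟩
  suc (count (p ∖ a)) ≤⟨ s≤s (count-mono (λ x e → let px , x≢a = ∖⇒ p e in h x px x≢a)) ⟩
  suc (count q)       ∎
  where open ≤-Reasoning

count-injective : ∀ {m n} {p : Fin m → Bool} {q : Fin n → Bool} (f : Fin m → Fin n) →
  Injective _≡_ _≡_ f → (∀ x → p x ≡ true → q (f x) ≡ true) → count p ≤ count q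
count-injective {zero}          f f-inj h = z≤n
count-injective {suc m} {p = p} {q} f f-inj h with p zero in p0
... | false = count-injective (f ∘ suc) (Fin.suc-injective ∘ f-inj) (h ∘ suc)
... | true  rewrite count-∖ q (h zero p0) =
  s≤s (count-injective (f ∘ suc) (Fin.suc-injective ∘ f-inj) avoids-f0)
  where
  avoids-f0 : ∀ x → p (suc x) ≡ true → (q ∖ f zero) (f (suc x)) ≡ true
  avoids-f0 x px with f (suc x) ≟ᶠ f zero
  ... | yes e = ⊥-elim (Fin.0≢1+n (≡.sym (f-inj e)))
  ... | no _  rewrite h (suc x) px = refl

count≢0⇒∃ : ∀ {n} (p : Fin n → Bool) → count p ≢ 0 → ∃ λ x → p x ≡ true
count≢0⇒∃ {zero}  p c≢0 = ⊥-elim (c≢0 refl)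
count≢0⇒∃ {suc n} p c≢0 with p zero in p0
... | true  = zero , p0
... | false = let x , px = count≢0⇒∃ (p ∘ suc) c≢0 in suc x , px

count≡0⊎∃ : ∀ {n} (p : Fin n → Bool) → count p ≡ 0 ⊎ ∃ λ x → p x ≡ true
count≡0⊎∃ p with count p ≟ 0
... | yes c≡0 = inj₁ c≡0
... | no c≢0  = inj₂ (count≢0⇒∃ p c≢0)

count≡0⇒false : ∀ {n} (p : Fin n → Bool) → count p ≡ 0 → ∀ x → p x ≡ false
count≡0⇒false p c≡0 x with p x in px
... | false = refl
... | true  = ⊥-elim (1+n≢0 (trans (≡.sym (count-∖ p px)) c≡0))

count-∧≡0⇒ : ∀ {n} (p q : Fin n → Bool) → count (λ x → p x ∧ q x) ≡ 0 →
  ∀ {x} → p x ≡ true → q x ≡ false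
count-∧≡0⇒ p q c≡0 {x} px = trans (cong (_∧ q x) (≡.sym px)) (count≡0⇒false (λ x → p x ∧ q x) c≡0 x)

count≤1 : ∀ {n} (p : Fin n → Bool) → (∀ {a b} → p a ≡ true → p b ≡ true → a ≡ b) → count p ≤ 1
count≤1 {n} p unique with count≡0⊎∃ p
... | inj₁ c≡0      = ≤-trans (≤-reflexive c≡0) z≤n
... | inj₂ (a , pa) = ≤-trans (count-mono-except pa (λ x px x≢a → ⊥-elim (x≢a (unique px pa))))
                              (s≤s (≤-reflexive (count-false {n})))

sum-mono-≤ : ∀ {n} {f g : Fin n → ℕ} → (∀ i → f i ≤ g i) → sum f ≤ sum g
sum-mono-≤ {zero}  f≤g = z≤n
sum-mono-≤ {suc n} f≤g = +-mono-≤ (f≤g zero) (sum-mono-≤ (f≤g ∘ suc))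

sum-const : ∀ n c → sum {n} (λ _ → c) ≡ n * c
sum-const zero    c = refl
sum-const (suc n) c = cong (c +_) (sum-const n c)

∑-count-transpose : ∀ {m n} (r : Fin m → Fin n → Bool) →
  sum (λ i → count (r i)) ≡ sum (λ j → count (λ i → r i j))
∑-count-transpose r = begin
  sum (λ i → count (r i))                  ≡⟨ sum-cong-≗ (λ i → count≡sum (r i)) ⟩
  sum (λ i → sum (λ j → iverson (r i j)))  ≡⟨ ∑-comm (λ i j → iverson (r i j)) ⟩
  sum (λ j → sum (λ i → iverson (r i j)))  ≡⟨ sum-cong-≗ (λ j → ≡.sym (count≡sum (λ i → r i j))) ⟩
  sum (λ j → count (λ i → r i j))          ∎
  where open ≡-Reasoning

maxOver-attained : ∀ {n} (p : Fin n → Bool) (f : Fin n → ℕ) → maxOver p f ≢ 0 →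
  ∃ λ w → p w ≡ true × maxOver p f ≡ f w
maxOver-attained {zero}  p f m≢0 = ⊥-elim (m≢0 refl)
maxOver-attained {suc n} p f m≢0
  with ⊔-sel (if p zero then f zero else 0) (maxOver (p ∘ suc) (f ∘ suc))
... | inj₂ m≡rest =
  let w , pw , e = maxOver-attained (p ∘ suc) (f ∘ suc) (m≢0 ∘ trans m≡rest) in
  suc w , pw , trans m≡rest e
... | inj₁ m≡head with p zero in p0
...   | true  = zero , p0 , m≡head
...   | false = ⊥-elim (m≢0 m≡head)

4a[a+r]≤[2a+r]² : ∀ a r → 4 * (a * (a + r)) ≤ (a + (a + r)) * (a + (a + r))
4a[a+r]≤[2a+r]² a r = ≤-trans (m≤m+n _ (r * r)) (≤-reflexive (square-expansion a r))
  where
  square-expansion : ∀ a r → 4 * (a * (a + r)) + r * r ≡ (a + (a + r)) * (a + (a + r))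
  square-expansion = solve-∀

4ab≤[a+b]² : ∀ a b → 4 * (a * b) ≤ (a + b) * (a + b)
4ab≤[a+b]² a b with ≤-total a b
... | inj₁ a≤b = subst (λ b → 4 * (a * b) ≤ (a + b) * (a + b)) (m+[n∸m]≡n a≤b) (4a[a+r]≤[2a+r]² a (b ∸ a))
... | inj₂ b≤a = subst₂ _≤_ (cong (4 *_) (*-comm b a)) (cong (λ t → t * t) (+-comm b a))
                   (subst (λ a → 4 * (b * a) ≤ (b + a) * (b + a)) (m+[n∸m]≡n b≤a) (4a[a+r]≤[2a+r]² b (a ∸ b)))

4[k∸s]s≤k² : ∀ k s → 4 * ((k ∸ s) * s) ≤ k * k
4[k∸s]s≤k² k s with ≤-total s k
... | inj₁ s≤k = subst (λ t → 4 * ((k ∸ s) * s) ≤ t * t) (m∸n+n≡m s≤k) (4ab≤[a+b]² (k ∸ s) s)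
... | inj₂ k≤s rewrite m≤n⇒m∸n≡0 k≤s = z≤n

-- Degrees and the handshake lemma

adj⇒≢ : ∀ {n} (G : Graph n) {i j} → adj G i j ≡ true → i ≢ j
adj⇒≢ G {i} e refl = false≢true (trans (≡.sym (irrefl G i)) e)

upperDegree : ∀ {n} → Graph n → Fin n → ℕ
upperDegree G i = count (λ j → ⌊ i <ᶠ? j ⌋ ∧ adj G i j)

-- numEdges sums with a function local to Defs, which cannot be named; unification recovers it
-- from numEdges of any graph, since it does not use its graph arguments.
private
  edgeless : ∀ n → Graph n
  edgeless n = record { adj = λ _ _ → false ; sym = λ _ _ → refl ; irrefl = λ _ → refl }

  mutual
    sumFin : ∀ {m} → (Fin m → ℕ) → ℕ
    sumFin = _

    numEdges-edgeless : ∀ {n} → sumFin (upperDegree (edgeless n)) ≡ numEdges (edgeless n)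
    numEdges-edgeless {n} with upperDegree (edgeless n)
    ... | f = refl

  sumFin≡sum : ∀ {m} (f : Fin m → ℕ) → sumFin f ≡ sum f
  sumFin≡sum {zero}  f = refl
  sumFin≡sum {suc m} f = cong (f zero +_) (sumFin≡sum (f ∘ suc))

numEdges≡∑upperDegree : ∀ {n} (G : Graph n) → numEdges G ≡ sum (upperDegree G)
numEdges≡∑upperDegree G = sumFin≡sum (upperDegree G)

not-upper≡lower : ∀ {n} (G : Graph n) i j → (not ⌊ i <ᶠ? j ⌋ ∧ adj G i j) ≡ (⌊ j <ᶠ? i ⌋ ∧ adj G i j)
not-upper≡lower G i j with i <ᶠ? j | j <ᶠ? i
... | yes i<j | yes j<i = ⊥-elim (Fin.<-asym i<j j<i)
... | yes _   | no _    = refl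
... | no _    | yes _   = refl
... | no i≮j  | no j≮i  with Fin.<-cmp i j
...   | tri< i<j _ _  = ⊥-elim (i≮j i<j)
...   | tri> _ _ j<i  = ⊥-elim (j≮i j<i)
...   | tri≈ _ refl _ = irrefl G i

handshake : ∀ {n} (G : Graph n) → sum (deg G) ≡ 2 * numEdges G
handshake G = begin
  sum (deg G)                                 ≡⟨ sum-cong-≗ deg≡upper+lower ⟩
  sum (λ i → upperDegree G i + lowerDegree i) ≡⟨ ∑-distrib-+ (upperDegree G) lowerDegree ⟩
  sum (upperDegree G) + sum lowerDegree       ≡⟨ cong (sum (upperDegree G) +_) ∑lower≡∑upper ⟩
  sum (upperDegree G) + sum (upperDegree G)   ≡⟨ cong (λ e → e + e) (≡.sym (numEdges≡∑upperDegree G)) ⟩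
  numEdges G + numEdges G                     ≡⟨ cong (numEdges G +_) (≡.sym (+-identityʳ (numEdges G))) ⟩
  2 * numEdges G                              ∎
  where
  open ≡-Reasoning
  lowerDegree : Fin _ → ℕ
  lowerDegree i = count (λ j → ⌊ j <ᶠ? i ⌋ ∧ adj G i j)
  deg≡upper+lower : ∀ i → deg G i ≡ upperDegree G i + lowerDegree i
  deg≡upper+lower i = trans (count-split (λ j → ⌊ i <ᶠ? j ⌋) (adj G i))
                            (cong (upperDegree G i +_) (count-cong (not-upper≡lower G i)))
  ∑lower≡∑upper : sum lowerDegree ≡ sum (upperDegree G)
  ∑lower≡∑upper = trans (∑-count-transpose (λ i j → ⌊ j <ᶠ? i ⌋ ∧ adj G i j))
                        (sum-cong-≗ (λ j → count-cong (λ i → cong (⌊ j <ᶠ? i ⌋ ∧_) (Graph.sym G i j))))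

inN⇒ : ∀ {h} (H : Graph h) {u v w} → inN H u v w ≡ true →
  (adj H u w ≡ true × w ≢ v) ⊎ (adj H v w ≡ true × w ≢ u)
inN⇒ H {u} {v} {w} e with (adj H u ∖ v) w in uw
... | true  = inj₁ (∖⇒ (adj H u) uw)
... | false = inj₂ (∖⇒ (adj H v) e)

addEdge⇒ : ∀ {n} (G : Graph n) {x y a b} → addEdge G x y a b ≡ true →
  adj G a b ≡ true ⊎ (a ≡ x × b ≡ y) ⊎ (a ≡ y × b ≡ x)
addEdge⇒ G {x} {y} {a} {b} e with adj G a b | a ≟ᶠ x | b ≟ᶠ y | a ≟ᶠ y | b ≟ᶠ x
... | true  | _       | _       | _       | _       = inj₁ refl
... | false | yes a≡x | yes b≡y | _       | _       = inj₂ (inj₁ (a≡x , b≡y))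
... | false | _       | _       | yes a≡y | yes b≡x = inj₂ (inj₂ (a≡y , b≡x))
... | false | no _    | _       | no _    | _       = ⊥-elim (false≢true e)
... | false | no _    | _       | yes _   | no _    = ⊥-elim (false≢true e)
... | false | yes _   | no _    | no _    | _       = ⊥-elim (false≢true e)
... | false | yes _   | no _    | yes _   | no _    = ⊥-elim (false≢true e)

-- Copies of H in G + xy

module Embedding {h n} {H : Graph h} {G : Graph n} {x y : Fin n}
  (f : Fin h → Fin n) (f-inj : Injective _≡_ _≡_ f)
  (f-hom : ∀ i j → adj H i j ≡ true → addEdge G x y (f i) (f j) ≡ true) where

  uses-new-edge : ¬ Contains H (adj G) → ∃₂ λ u v → adj H u v ≡ true × f u ≡ x × f v ≡ y
  uses-new-edge G⊉H with Fin.any? (λ u → Fin.any? (λ v →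
                           (adj H u v ≟ᵇ true) ×-dec (f u ≟ᶠ x) ×-dec (f v ≟ᶠ y)))
  ... | yes (u , v , uv , fu , fv) = u , v , uv , fu , fv
  ... | no none = ⊥-elim (G⊉H (f , f-inj , f-hom-G))
    where
    f-hom-G : ∀ i j → adj H i j ≡ true → adj G (f i) (f j) ≡ true
    f-hom-G i j ij with addEdge⇒ G (f-hom i j ij)
    ... | inj₁ e                = e
    ... | inj₂ (inj₁ (fi , fj)) = ⊥-elim (none (i , j , ij , fi , fj))
    ... | inj₂ (inj₂ (fi , fj)) = ⊥-elim (none (j , i , trans (Graph.sym H j i) ij , fj , fi))

  module _ {u v : Fin h} (uv : adj H u v ≡ true) (fu : f u ≡ x) (fv : f v ≡ y) where

    edge-preserved : ∀ {i j} → adj H i j ≡ true → (i ≢ u ⊎ j ≢ v) → (i ≢ v ⊎ j ≢ u) →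
      adj G (f i) (f j) ≡ true
    edge-preserved {i} {j} ij not-uv not-vu with addEdge⇒ G (f-hom i j ij)
    ... | inj₁ e = e
    ... | inj₂ (inj₁ (fi , fj)) =
      ⊥-elim ([ _$ f-inj (trans fi (≡.sym fu)) , _$ f-inj (trans fj (≡.sym fv)) ]′ not-uv)
    ... | inj₂ (inj₂ (fi , fj)) =
      ⊥-elim ([ _$ f-inj (trans fi (≡.sym fv)) , _$ f-inj (trans fj (≡.sym fu)) ]′ not-vu)

    Endpoints : Fin h → Fin h → Set
    Endpoints a b = (a ≡ u × b ≡ v) ⊎ (a ≡ v × b ≡ u)

    u≢v : u ≢ v
    u≢v = adj⇒≢ H uv

    endpoint-adj : ∀ {a b} → Endpoints a b → adj H a b ≡ true
    endpoint-adj (inj₁ (refl , refl)) = uv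
    endpoint-adj (inj₂ (refl , refl)) = trans (Graph.sym H v u) uv

    endpoint-edge-preserved : ∀ {a b t} → Endpoints a b → adj H a t ≡ true → t ≢ b →
      adj G (f a) (f t) ≡ true
    endpoint-edge-preserved (inj₁ (refl , refl)) e t≢v = edge-preserved e (inj₂ t≢v) (inj₁ u≢v)
    endpoint-edge-preserved (inj₂ (refl , refl)) e t≢u = edge-preserved e (inj₁ (u≢v ∘ ≡.sym)) (inj₂ t≢u)

    deg-endpoint : ∀ {a b} → Endpoints a b → deg H a ≤ suc (deg G (f a))
    deg-endpoint {a} {b} ends = begin
      deg H a                   ≡⟨ count-∖ (adj H a) (endpoint-adj ends) ⟩
      suc (count (adj H a ∖ b)) ≤⟨ s≤s (count-injective f f-inj (λ t e →
                                     let at , t≢b = ∖⇒ (adj H a) e in endpoint-edge-preserved ends at t≢b)) ⟩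
      suc (deg G (f a))         ∎
      where open ≤-Reasoning

    deg-interior : ∀ {w} → w ≢ u → w ≢ v → deg H w ≤ deg G (f w)
    deg-interior w≢u w≢v = count-injective f f-inj (λ t e → edge-preserved e (inj₁ w≢u) (inj₁ w≢v))

    wt0-bound : wt0 H u v ≤ deg G x ⊔ deg G y
    wt0-bound = ∸-monoˡ-≤ 1 (⊔-mono-≤
      (subst (λ z → deg H u ≤ suc (deg G z)) fu (deg-endpoint (inj₁ (refl , refl))))
      (subst (λ z → deg H v ≤ suc (deg G z)) fv (deg-endpoint (inj₂ (refl , refl)))))

    wt1-bound : wt1 H u v ≢ 0 → ∃ λ z → (adj G x z ≡ true ⊎ adj G y z ≡ true) × wt1 H u v ≤ deg G z
    wt1-bound wt1≢0 with maxOver-attained (inN H u v) (deg H) wt1≢0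
    ... | w , w∈N , wt1≡deg-w with inN⇒ H w∈N
    ...   | inj₁ (uw , w≢v) =
      f w , inj₁ (subst (λ z → adj G z (f w) ≡ true) fu (endpoint-edge-preserved (inj₁ (refl , refl)) uw w≢v)) ,
      ≤-trans (≤-reflexive wt1≡deg-w) (deg-interior (adj⇒≢ H uw ∘ ≡.sym) w≢v)
    ...   | inj₂ (vw , w≢u) =
      f w , inj₂ (subst (λ z → adj G z (f w) ≡ true) fv (endpoint-edge-preserved (inj₂ (refl , refl)) vw w≢u)) ,
      ≤-trans (≤-reflexive wt1≡deg-w) (deg-interior w≢u (adj⇒≢ H vw ∘ ≡.sym))

record SaturationWitness {h n} (H : Graph h) (G : Graph n) (x y : Fin n) : Set where
  field
    u v       : Fin h
    uv        : adj H u v ≡ true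
    wt0-bound : wt0 H u v ≤ deg G x ⊔ deg G y
    wt1-bound : wt1 H u v ≢ 0 → ∃ λ z → (adj G x z ≡ true ⊎ adj G y z ≡ true) × wt1 H u v ≤ deg G z

saturated⇒witness : ∀ {h n} {H : Graph h} {G : Graph n} → Saturated H G →
  ∀ {x y} → x ≢ y → adj G x y ≡ false → SaturationWitness H G x y
saturated⇒witness {H = H} {G} (G⊉H , saturated) {x} {y} x≢y xy∉G =
  let f , f-inj , f-hom = saturated x y x≢y xy∉G
      open Embedding {H = H} {G} {x} {y} f f-inj f-hom
      u , v , uv , fu , fv = uses-new-edge G⊉H
  in record { u = u ; v = v ; uv = uv ; wt0-bound = wt0-bound uv fu fv ; wt1-bound = wt1-bound uv fu fv }

module _ {h n} {H : Graph h} {G : Graph n} (sat : Saturated H G) {x y : Fin n}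
  (x≢y : x ≢ y) (xy∉G : adj G x y ≡ false) where

  open SaturationWitness (saturated⇒witness {H = H} {G} sat {x} {y} x≢y xy∉G)

  nonadjacent⇒≤max-deg : ∀ {k} → (∀ {u v} → adj H u v ≡ true → k ≤ wt0 H u v) →
    k ≤ deg G x ⊔ deg G y
  nonadjacent⇒≤max-deg k≤wt0 = ≤-trans (k≤wt0 uv) wt0-bound

  nonadjacent-low⇒high-neighbour : ∀ {k0 k1'} → 0 < k1' →
    (∀ {u v} → adj H u v ≡ true → k0 ≤ wt0 H u v) →
    (∀ {u v} → adj H u v ≡ true → wt0 H u v ≡ k0 → k1' ≤ wt1 H u v) →
    deg G x ≤ k0 → deg G y ≤ k0 →
    ∃ λ z → (adj G x z ≡ true ⊎ adj G y z ≡ true) × k1' ≤ deg G z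
  nonadjacent-low⇒high-neighbour 0<k1' k0≤wt0 k1'≤wt1 x-low y-low =
    let k1'≤wt1uv = k1'≤wt1 uv (≤-antisym (≤-trans wt0-bound (⊔-lub x-low y-low)) (k0≤wt0 uv))
        z , xz⊎yz , wt1≤dz = wt1-bound (m<n⇒n≢0 (<-≤-trans 0<k1' k1'≤wt1uv))
    in z , xz⊎yz , ≤-trans k1'≤wt1uv wt1≤dz

  nonadjacent-below⇒neighbour-above : ∀ {k0 k0'} →
    (∀ {u v} → adj H u v ≡ true → k0 ≤ wt1 H u v) →
    (∀ {u v} → adj H u v ≡ true → wt1 H u v ≡ k0 → k0' ≤ wt0 H u v) →
    deg G x < k0' → deg G y < k0' →
    ∃ λ z → (adj G x z ≡ true ⊎ adj G y z ≡ true) × k0 < deg G z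
  nonadjacent-below⇒neighbour-above k0≤wt1 k0'≤wt0 x-below y-below =
    let k0<wt1uv = ≤∧≢⇒< (k0≤wt1 uv) (λ k0≡wt1 →
                     <⇒≱ (⊔-pres-<m x-below y-below) (≤-trans (k0'≤wt0 uv (≡.sym k0≡wt1)) wt0-bound))
        z , xz⊎yz , wt1≤dz = wt1-bound (m<n⇒n≢0 k0<wt1uv)
    in z , xz⊎yz , <-≤-trans k0<wt1uv wt1≤dz

-- Discharging

-- The hypotheses say that a vertex of degree k0' (resp. k1') can give p to each of k0' + 1
-- (resp. k1') neighbours and keep q·k0.
module Balance {k0 k0' k1' p q : ℕ} (k0<k1' : k0 < k1') (p≤q : p ≤ q)
  (affordable-k0' : q * k0 + p * suc k0' ≤ q * k0')
  (affordable-k1' : q * k0 + p * k1' ≤ q * k1') where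

  affordable-extend : ∀ a b c t → a + p * b ≤ q * c → a + p * (b + t) ≤ q * (c + t)
  affordable-extend a b c t h = begin
    a + p * (b + t)     ≡⟨ cong (a +_) (*-distribˡ-+ p b t) ⟩
    a + (p * b + p * t) ≡⟨ ≡.sym (+-assoc a (p * b) (p * t)) ⟩
    a + p * b + p * t   ≤⟨ +-mono-≤ h (*-monoˡ-≤ t p≤q) ⟩
    q * c + q * t       ≡⟨ ≡.sym (*-distribˡ-+ q c t) ⟩
    q * (c + t)         ∎
    where open ≤-Reasoning

  affordable-above-k0' : ∀ {D} → k0' ≤ D → q * k0 + p * suc D ≤ q * D
  affordable-above-k0' {D} k0'≤D = subst (λ D → q * k0 + p * suc D ≤ q * D) (m+[n∸m]≡n k0'≤D)
    (affordable-extend (q * k0) (suc k0') k0' (D ∸ k0') affordable-k0')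

  affordable-above-k1' : ∀ {D} → k1' ≤ D → q * k0 + p * D ≤ q * D
  affordable-above-k1' {D} k1'≤D = subst (λ D → q * k0 + p * D ≤ q * D) (m+[n∸m]≡n k1'≤D)
    (affordable-extend (q * k0) k1' k1' (D ∸ k1') affordable-k1')

  +p+p*≡+p*suc : ∀ a x → a + p + p * x ≡ a + p * suc x
  +p+p*≡+p*suc a x = trans (+-assoc a p (p * x)) (cong (a +_) (≡.sym (*-suc p x)))

  low-balance : ∀ {D hN l b} → D ≤ k0 → 1 ≤ hN + l →
    q * k0 + p ≤ q * D + p * hN + (q * (k0 ∸ D) + p * (l + b))
  low-balance {D} {hN} {l} {b} D≤k0 1≤hN+l = begin
    q * k0 + p
      ≡⟨ cong₂ (λ k r → q * k + r) (≡.sym (m+[n∸m]≡n D≤k0)) (≡.sym (*-identityʳ p)) ⟩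
    q * (D + (k0 ∸ D)) + p * 1
      ≤⟨ +-monoʳ-≤ _ (*-monoʳ-≤ p (≤-trans 1≤hN+l (+-monoʳ-≤ hN (m≤m+n l b)))) ⟩
    q * (D + (k0 ∸ D)) + p * (hN + (l + b))
      ≡⟨ regroup q D (k0 ∸ D) p hN l b ⟩
    q * D + p * hN + (q * (k0 ∸ D) + p * (l + b)) ∎
    where
    open ≤-Reasoning
    regroup : ∀ q D t p h l b → q * (D + t) + p * (h + (l + b)) ≡ q * D + p * h + (q * t + p * (l + b))
    regroup = solve-∀

  mid-balance : ∀ {D} → k0 < D → q * k0 + p ≤ q * D
  mid-balance {D} k0<D = begin
    q * k0 + p  ≤⟨ +-monoʳ-≤ (q * k0) p≤q ⟩
    q * k0 + q  ≡⟨ +-comm (q * k0) q ⟩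
    q + q * k0  ≡⟨ ≡.sym (*-suc q k0) ⟩
    q * suc k0  ≤⟨ *-monoʳ-≤ q k0<D ⟩
    q * D       ∎
    where open ≤-Reasoning

  high-balance : ∀ {D lN b} → k1' ≤ D → lN ≤ D → (D < k0' → b ≡ 1 ⊎ suc lN ≤ D) →
    q * k0 + p + p * lN ≤ q * D + p * b
  high-balance {D} {lN} {b} k1'≤D lN≤D captive-or-spare with k0' ≤? D
  ... | yes k0'≤D = begin
    q * k0 + p + p * lN    ≡⟨ +p+p*≡+p*suc (q * k0) lN ⟩
    q * k0 + p * suc lN    ≤⟨ +-monoʳ-≤ (q * k0) (*-monoʳ-≤ p (s≤s lN≤D)) ⟩
    q * k0 + p * suc D     ≤⟨ affordable-above-k0' k0'≤D ⟩
    q * D                  ≤⟨ m≤m+n (q * D) (p * b) ⟩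
    q * D + p * b          ∎
    where open ≤-Reasoning
  ... | no k0'≰D with captive-or-spare (≰⇒> k0'≰D)
  ...   | inj₂ suc-lN≤D = begin
    q * k0 + p + p * lN    ≡⟨ +p+p*≡+p*suc (q * k0) lN ⟩
    q * k0 + p * suc lN    ≤⟨ +-monoʳ-≤ (q * k0) (*-monoʳ-≤ p suc-lN≤D) ⟩
    q * k0 + p * D         ≤⟨ affordable-above-k1' k1'≤D ⟩
    q * D                  ≤⟨ m≤m+n (q * D) (p * b) ⟩
    q * D + p * b          ∎
    where open ≤-Reasoning
  ...   | inj₁ refl = begin
    q * k0 + p + p * lN    ≡⟨ +-assoc (q * k0) p (p * lN) ⟩
    q * k0 + (p + p * lN)  ≡⟨ cong (q * k0 +_) (+-comm p (p * lN)) ⟩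
    q * k0 + (p * lN + p)  ≡⟨ ≡.sym (+-assoc (q * k0) (p * lN) p) ⟩
    q * k0 + p * lN + p    ≤⟨ +-monoˡ-≤ p (+-monoʳ-≤ (q * k0) (*-monoʳ-≤ p lN≤D)) ⟩
    q * k0 + p * D + p     ≤⟨ +-monoˡ-≤ p (affordable-above-k1' k1'≤D) ⟩
    q * D + p              ≡⟨ cong (q * D +_) (≡.sym (*-identityʳ p)) ⟩
    q * D + p * 1          ∎
    where open ≤-Reasoning

  +p*0≡ : ∀ a → a + p * 0 ≡ a
  +p*0≡ a = trans (cong (a +_) (*-zeroʳ p)) (+-identityʳ a)

  -- A vertex of degree D with hN high and lN low neighbours; l and b indicate whether it is
  -- lonely or captive.
  balance : ∀ {D hN lN l b} (low? : Dec (D ≤ k0)) (high? : Dec (k1' ≤ D)) →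
    (D ≤ k0 → hN ≡ 0 → l ≡ 1) → lN ≤ D → (k1' ≤ D → D < k0' → b ≡ 1 ⊎ suc lN ≤ D) →
    q * k0 + p + p * (if ⌊ high? ⌋ then lN else 0) ≤
      q * D + p * (if ⌊ low? ⌋ then hN else 0) + (q * (k0 ∸ D) + p * (l + b))
  balance (yes D≤k0) (yes k1'≤D) _ _ _ = ⊥-elim (<⇒≱ (<-≤-trans k0<k1' k1'≤D) D≤k0)
  balance {D} {hN} {l = l} {b} (yes D≤k0) (no _) alone⇒lonely _ _ =
    ≤-trans (≤-reflexive (+p*0≡ (q * k0 + p))) (low-balance D≤k0 (1≤hN+l hN (alone⇒lonely D≤k0)))
    where
    1≤hN+l : ∀ hN → (hN ≡ 0 → l ≡ 1) → 1 ≤ hN + l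
    1≤hN+l zero    l≡1 = ≤-reflexive (≡.sym (l≡1 refl))
    1≤hN+l (suc _) _   = s≤s z≤n
  balance {D} (no D≰k0) (no _) _ _ _ = begin
    q * k0 + p + p * 0      ≡⟨ +p*0≡ (q * k0 + p) ⟩
    q * k0 + p              ≤⟨ mid-balance (≰⇒> D≰k0) ⟩
    q * D                   ≤⟨ m≤m+n _ _ ⟩
    q * D + p * 0           ≤⟨ m≤m+n _ _ ⟩
    q * D + p * 0 + _       ∎
    where open ≤-Reasoning
  balance {D} {l = l} {b} (no D≰k0) (yes k1'≤D) _ lN≤D captive-or-spare = begin
    q * k0 + p + p * _      ≤⟨ high-balance k1'≤D lN≤D (captive-or-spare k1'≤D) ⟩
    q * D + p * b           ≤⟨ +-monoʳ-≤ (q * D) (≤-trans (*-monoʳ-≤ p (m≤n+m b l)) (m≤n+m _ _)) ⟩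
    q * D + (q * (k0 ∸ D) + p * (l + b))
                            ≤⟨ +-monoˡ-≤ _ (m≤m+n (q * D) (p * 0)) ⟩
    q * D + p * 0 + (q * (k0 ∸ D) + p * (l + b)) ∎
    where open ≤-Reasoning

module Structure {h n} {H : Graph h} {G : Graph n} (sat : Saturated H G) {k0 k0' k1' : ℕ}
  (k0<k1' : k0 < k1') (k1'<k0' : k1' < k0')
  (k0≤wt0  : ∀ {u v} → adj H u v ≡ true → k0 ≤ wt0 H u v)
  (k0≤wt1  : ∀ {u v} → adj H u v ≡ true → k0 ≤ wt1 H u v)
  (k0'≤wt0 : ∀ {u v} → adj H u v ≡ true → wt1 H u v ≡ k0 → k0' ≤ wt0 H u v)
  (k1'≤wt1 : ∀ {u v} → adj H u v ≡ true → wt0 H u v ≡ k0 → k1' ≤ wt1 H u v) where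

  d : Fin n → ℕ
  d = deg G

  low high small : Fin n → Bool
  low v   = ⌊ d v ≤? k0 ⌋
  high v  = ⌊ k1' ≤? d v ⌋
  small v = ⌊ d v <? k0 ⌋

  highNbrs lowNbrs nonLowNbrs : Fin n → ℕ
  highNbrs v   = count (λ w → adj G v w ∧ high w)
  lowNbrs v    = count (λ w → adj G v w ∧ low w)
  nonLowNbrs v = count (λ w → adj G v w ∧ not (low w))

  lonely captive : Fin n → Bool
  lonely v  = low v ∧ ⌊ highNbrs v ≟ 0 ⌋
  captive v = high v ∧ ⌊ d v <? k0' ⌋ ∧ ⌊ nonLowNbrs v ≟ 0 ⌋

  low⇒ : ∀ v → low v ≡ true → d v ≤ k0
  low⇒ v = ⌊⌋-true⁻¹ (d v ≤? k0)

  lonely⇒ : ∀ v → lonely v ≡ true → d v ≤ k0 × (∀ {z} → adj G v z ≡ true → ¬ k1' ≤ d z)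
  lonely⇒ v lv =
    low⇒ v (∧-conicalˡ (low v) _ lv) ,
    λ {z} vz k1'≤dz →
      false≢true (trans (≡.sym (count-∧≡0⇒ (adj G v) high no-high vz)) (⌊⌋-true (k1' ≤? d z) k1'≤dz))
    where
    no-high : highNbrs v ≡ 0
    no-high = ⌊⌋-true⁻¹ (highNbrs v ≟ 0) (∧-conicalʳ (low v) _ lv)

  captive⇒ : ∀ v → captive v ≡ true → k1' ≤ d v × d v < k0' × (∀ {z} → adj G v z ≡ true → d z ≤ k0)
  captive⇒ v cv =
    ⌊⌋-true⁻¹ (k1' ≤? d v) (∧-conicalˡ (high v) _ cv) ,
    ⌊⌋-true⁻¹ (d v <? k0') (∧-conicalˡ ⌊ d v <? k0' ⌋ _ rest) ,
    λ {z} vz → low⇒ z (not-injective (count-∧≡0⇒ (adj G v) (not ∘ low) no-nonlow vz))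
    where
    rest : (⌊ d v <? k0' ⌋ ∧ ⌊ nonLowNbrs v ≟ 0 ⌋) ≡ true
    rest = ∧-conicalʳ (high v) _ cv
    no-nonlow : nonLowNbrs v ≡ 0
    no-nonlow = ⌊⌋-true⁻¹ (nonLowNbrs v ≟ 0) (∧-conicalʳ ⌊ d v <? k0' ⌋ _ rest)

  small-adjacent : ∀ {v w} → small v ≡ true → small w ≡ true → w ≢ v → adj G v w ≡ true
  small-adjacent {v} {w} sv sw w≢v with adj G v w in vw
  ... | true  = refl
  ... | false = ⊥-elim (<⇒≱ (⊔-pres-<m (⌊⌋-true⁻¹ (d v <? k0) sv) (⌊⌋-true⁻¹ (d w <? k0) sw))
                             (nonadjacent⇒≤max-deg {H = H} {G} sat (w≢v ∘ ≡.sym) vw k0≤wt0))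

  lonely-adjacent : ∀ {v w} → lonely v ≡ true → lonely w ≡ true → w ≢ v → adj G v w ≡ true
  lonely-adjacent {v} {w} lv lw w≢v with adj G v w in vw
  ... | true  = refl
  ... | false =
    let v-low , v-alone = lonely⇒ v lv
        w-low , w-alone = lonely⇒ w lw
        z , vz⊎wz , k1'≤dz = nonadjacent-low⇒high-neighbour {H = H} {G} sat (w≢v ∘ ≡.sym) vw
                               (≤-<-trans z≤n k0<k1') k0≤wt0 k1'≤wt1 v-low w-low
    in ⊥-elim ([ (λ vz → v-alone vz k1'≤dz) , (λ wz → w-alone wz k1'≤dz) ]′ vz⊎wz)

  captive-unique : ∀ {v w} → captive v ≡ true → captive w ≡ true → v ≡ w
  captive-unique {v} {w} cv cw with v ≟ᶠ w
  ... | yes v≡w = v≡w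
  ... | no v≢w with captive⇒ v cv | captive⇒ w cw | adj G v w in vw
  ...   | _ , _ , v-nbrs-low | k1'≤dw , _ , _ | true =
    ⊥-elim (<⇒≱ (<-≤-trans k0<k1' k1'≤dw) (v-nbrs-low vw))
  ...   | _ , dv<k0' , v-nbrs-low | _ , dw<k0' , w-nbrs-low | false =
    let z , vz⊎wz , k0<dz = nonadjacent-below⇒neighbour-above {H = H} {G} sat v≢w vw k0≤wt1 k0'≤wt0 dv<k0' dw<k0'
    in ⊥-elim (<⇒≱ k0<dz ([ v-nbrs-low , w-nbrs-low ]′ vz⊎wz))

  lonely-count≤ : count lonely ≤ suc k0
  lonely-count≤ with count≡0⊎∃ lonely
  ... | inj₁ c≡0      = ≤-trans (≤-reflexive c≡0) z≤n
  ... | inj₂ (x , lx) = ≤-trans (count-mono-except lx (λ w lw w≢x → lonely-adjacent lx lw w≢x))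
                                (s≤s (proj₁ (lonely⇒ x lx)))

  lonely⊆closed-nbhd∖ : ∀ {x z'} → lonely x ≡ true → k0 < d z' →
    ∀ w → lonely w ≡ true → w ≢ x → (adj G x ∖ z') w ≡ true
  lonely⊆closed-nbhd∖ {x} {z'} lx k0<dz' w lw w≢x with w ≟ᶠ z'
  ... | yes refl = ⊥-elim (<⇒≱ k0<dz' (proj₁ (lonely⇒ w lw)))
  ... | no _     = trans (∧-identityʳ (adj G x w)) (lonely-adjacent lx lw w≢x)

  -- x and z are non-adjacent and of degree < k0', so x or z has a neighbour z' of degree > k0; as
  -- the neighbours of z are low, z' is adjacent to x, and the lonely vertices lie in N[x] ∖ {z'}.
  lonely-count≤-beside-captive : ∀ {x z} → lonely x ≡ true → captive z ≡ true → count lonely ≤ k0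
  lonely-count≤-beside-captive {x} {z} lx cz =
    let x-low , x-alone = lonely⇒ x lx
        k1'≤dz , dz<k0' , z-nbrs-low = captive⇒ z cz
        z' , xz'⊎zz' , k0<dz' = nonadjacent-below⇒neighbour-above {H = H} {G} sat
          (λ { refl → <⇒≱ (<-≤-trans k0<k1' k1'≤dz) x-low })
          (¬-not {adj G x z} {true} (λ xz → x-alone xz k1'≤dz))
          k0≤wt1 k0'≤wt0 (≤-<-trans x-low (<-trans k0<k1' k1'<k0')) dz<k0'
        xz' : adj G x z' ≡ true
        xz' = [ (λ xz' → xz') , (λ zz' → ⊥-elim (<⇒≱ k0<dz' (z-nbrs-low zz'))) ]′ xz'⊎zz'
    in begin
    count lonely                ≤⟨ count-mono-except lx (lonely⊆closed-nbhd∖ lx k0<dz') ⟩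
    suc (count (adj G x ∖ z'))  ≡⟨ ≡.sym (count-∖ (adj G x) xz') ⟩
    d x                         ≤⟨ x-low ⟩
    k0                          ∎
    where open ≤-Reasoning

  lonely+captive≤ : count lonely + count captive ≤ suc k0
  lonely+captive≤ with count≡0⊎∃ captive | count≡0⊎∃ lonely
  ... | inj₁ none | _ = subst (λ c → count lonely + c ≤ suc k0) (≡.sym none)
                              (≤-trans (≤-reflexive (+-identityʳ _)) lonely-count≤)
  ... | inj₂ _ | inj₁ none = subst (λ c → c + count captive ≤ suc k0) (≡.sym none)
                                   (≤-trans (count≤1 captive captive-unique) (s≤s z≤n))
  ... | inj₂ (z , cz) | inj₂ (x , lx) =
    ≤-trans (+-mono-≤ (lonely-count≤-beside-captive lx cz) (count≤1 captive captive-unique))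
            (≤-reflexive (+-comm k0 1))

  -- The small vertices form a clique, so a small vertex has degree at least count small − 1.
  deficit≤ : ∀ v → k0 ∸ d v ≤ iverson (small v) * (suc k0 ∸ count small)
  deficit≤ v with small v in sv
  ... | true  = ≤-trans (∸-monoʳ-≤ (suc k0) (count-mono-except sv (λ w sw w≢v → small-adjacent sv sw w≢v)))
                        (≤-reflexive (≡.sym (+-identityʳ _)))
  ... | false = ≤-reflexive (m≤n⇒m∸n≡0 (≮⇒≥ (⌊⌋-false⁻¹ (d v <? k0) sv)))

  4∑deficit≤ : 4 * sum (λ v → k0 ∸ d v) ≤ suc k0 * suc k0
  4∑deficit≤ = ≤-trans (*-monoʳ-≤ 4 ∑deficit≤) (4[k∸s]s≤k² (suc k0) (count small))
    where
    open ≤-Reasoning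
    room : ℕ
    room = suc k0 ∸ count small
    ∑deficit≤ : sum (λ v → k0 ∸ d v) ≤ room * count small
    ∑deficit≤ = begin
      sum (λ v → k0 ∸ d v)                 ≤⟨ sum-mono-≤ deficit≤ ⟩
      sum (λ v → iverson (small v) * room) ≡⟨ sum-cong-≗ (λ v → *-comm (iverson (small v)) room) ⟩
      sum (λ v → room * iverson (small v)) ≡⟨ ≡.sym (*-distribˡ-sum room (iverson ∘ small)) ⟩
      room * sum (iverson ∘ small)         ≡⟨ cong (room *_) (≡.sym (count≡sum small)) ⟩
      room * count small                   ∎

  module Discharge {p q : ℕ} (p≤q : p ≤ q)
    (affordable-k0' : q * k0 + p * suc k0' ≤ q * k0')
    (affordable-k1' : q * k0 + p * k1' ≤ q * k1') where

    open Balance k0<k1' p≤q affordable-k0' affordable-k1'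

    -- Every low–high edge moves charge p from its high end to its low end.
    received sent slack : Fin n → ℕ
    received v = count (λ w → low v ∧ (adj G v w ∧ high w))
    sent v     = count (λ w → high v ∧ (adj G v w ∧ low w))
    slack v    = q * (k0 ∸ d v) + p * (iverson (lonely v) + iverson (captive v))

    ∑received≡∑sent : sum received ≡ sum sent
    ∑received≡∑sent = trans (∑-count-transpose (λ v w → low v ∧ (adj G v w ∧ high w)))
      (sum-cong-≗ (λ w → count-cong (λ v →
        trans (∧-rotate (low v) (adj G v w) (high w)) (cong (λ b → high w ∧ (b ∧ low v)) (Graph.sym G v w)))))

    lonely-if-alone : ∀ v → d v ≤ k0 → highNbrs v ≡ 0 → iverson (lonely v) ≡ 1
    lonely-if-alone v dv≤k0 hN≡0 =
      cong iverson (cong₂ _∧_ (⌊⌋-true (d v ≤? k0) dv≤k0) (⌊⌋-true (highNbrs v ≟ 0) hN≡0))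

    lowNbrs≤deg : ∀ v → lowNbrs v ≤ d v
    lowNbrs≤deg v = count-mono (λ w → ∧-conicalˡ (adj G v w) (low w))

    captive-or-spare : ∀ v → k1' ≤ d v → d v < k0' → iverson (captive v) ≡ 1 ⊎ suc (lowNbrs v) ≤ d v
    captive-or-spare v k1'≤dv dv<k0' with count≡0⊎∃ (λ w → adj G v w ∧ not (low w))
    ... | inj₁ none = inj₁ (cong iverson (cong₂ _∧_ (⌊⌋-true (k1' ≤? d v) k1'≤dv)
      (cong₂ _∧_ (⌊⌋-true (d v <? k0') dv<k0') (⌊⌋-true (nonLowNbrs v ≟ 0) none))))
    ... | inj₂ (z , e) = inj₂ (begin
      suc (lowNbrs v)            ≤⟨ s≤s (count-mono low-nbr-≢z) ⟩
      suc (count (adj G v ∖ z))  ≡⟨ ≡.sym (count-∖ (adj G v) vz) ⟩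
      d v                        ∎)
      where
      open ≤-Reasoning
      vz : adj G v z ≡ true
      vz = ∧-conicalˡ (adj G v z) _ e
      low-nbr-≢z : ∀ w → (adj G v w ∧ low w) ≡ true → (adj G v ∖ z) w ≡ true
      low-nbr-≢z w e′ with w ≟ᶠ z
      ... | yes refl = ⊥-elim (false≢true (trans (cong not (≡.sym (∧-conicalʳ (adj G v w) (low w) e′)))
                                                 (∧-conicalʳ (adj G v w) (not (low w)) e)))
      ... | no _     = trans (∧-identityʳ (adj G v w)) (∧-conicalˡ (adj G v w) (low w) e′)

    vertex-balance : ∀ v → q * k0 + p + p * sent v ≤ q * d v + p * received v + slack v
    vertex-balance v
      rewrite count-∧ˡ (low v) (λ w → adj G v w ∧ high w) | count-∧ˡ (high v) (λ w → adj G v w ∧ low w) =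
      balance (d v ≤? k0) (k1' ≤? d v) (lonely-if-alone v) (lowNbrs≤deg v) (captive-or-spare v)

    discharging : n * (q * k0 + p) ≤ q * sum d + (q * sum (λ v → k0 ∸ d v) + p * (count lonely + count captive))
    discharging = +-cancelʳ-≤ (p * S) _ _ (begin
      n * (q * k0 + p) + p * S                              ≡⟨ ≡.sym ∑lhs ⟩
      sum (λ v → q * k0 + p + p * sent v)                   ≤⟨ sum-mono-≤ vertex-balance ⟩
      sum (λ v → q * d v + p * received v + slack v)        ≡⟨ ∑rhs ⟩
      q * sum d + p * S + (q * T + p * C)                   ≡⟨ swap (q * sum d) (p * S) (q * T + p * C) ⟩
      q * sum d + (q * T + p * C) + p * S                   ∎)
      where
      open ≤-Reasoning
      S T C : ℕ
      S = sum sent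
      T = sum (λ v → k0 ∸ d v)
      C = count lonely + count captive
      swap : ∀ a b c → a + b + c ≡ a + c + b
      swap = solve-∀
      ∑lhs : sum (λ v → q * k0 + p + p * sent v) ≡ n * (q * k0 + p) + p * S
      ∑lhs = trans (∑-distrib-+ (λ _ → q * k0 + p) (λ v → p * sent v))
                   (cong₂ _+_ (sum-const n (q * k0 + p)) (≡.sym (*-distribˡ-sum p sent)))
      ∑C : sum (λ v → iverson (lonely v) + iverson (captive v)) ≡ C
      ∑C = trans (∑-distrib-+ (iverson ∘ lonely) (iverson ∘ captive))
                 (≡.sym (cong₂ _+_ (count≡sum lonely) (count≡sum captive)))
      ∑rhs : sum (λ v → q * d v + p * received v + slack v) ≡ q * sum d + p * S + (q * T + p * C)
      ∑rhs = begin-equality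
        sum (λ v → q * d v + p * received v + slack v)
          ≡⟨ ∑-distrib-+ (λ v → q * d v + p * received v) slack ⟩
        sum (λ v → q * d v + p * received v) + sum slack
          ≡⟨ cong₂ _+_ (∑-distrib-+ (λ v → q * d v) (λ v → p * received v))
                       (∑-distrib-+ (λ v → q * (k0 ∸ d v)) (λ v → p * (iverson (lonely v) + iverson (captive v)))) ⟩
        sum (λ v → q * d v) + sum (λ v → p * received v) +
          (sum (λ v → q * (k0 ∸ d v)) + sum (λ v → p * (iverson (lonely v) + iverson (captive v))))
          ≡⟨ ≡.sym (cong₂ _+_ (cong₂ _+_ (*-distribˡ-sum q d) (*-distribˡ-sum p received))
                              (cong₂ _+_ (*-distribˡ-sum q (λ v → k0 ∸ d v))
                                         (*-distribˡ-sum p (λ v → iverson (lonely v) + iverson (captive v))))) ⟩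
        q * sum d + p * sum received + (q * T + p * sum (λ v → iverson (lonely v) + iverson (captive v)))
          ≡⟨ cong₂ (λ r c → q * sum d + p * r + (q * T + p * c)) ∑received≡∑sent ∑C ⟩
        q * sum d + p * S + (q * T + p * C) ∎

    core : 4 * (q * k0 + p) * n ≤ 8 * q * numEdges G + (q * (suc k0 * suc k0) + 4 * p * suc k0)
    core = begin
      4 * (q * k0 + p) * n                         ≡⟨ commute (q * k0 + p) n ⟩
      4 * (n * (q * k0 + p))                       ≤⟨ *-monoʳ-≤ 4 discharging ⟩
      4 * (q * sum d + (q * T + p * C))            ≡⟨ cong (λ s → 4 * (q * s + (q * T + p * C))) (handshake G) ⟩
      4 * (q * (2 * E) + (q * T + p * C))          ≡⟨ distribute q E T p C ⟩
      8 * q * E + (q * (4 * T) + 4 * p * C)        ≤⟨ +-monoʳ-≤ (8 * q * E) (+-mono-≤ (*-monoʳ-≤ q 4∑deficit≤)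
                                                                              (*-monoʳ-≤ (4 * p) lonely+captive≤)) ⟩
      8 * q * E + (q * (suc k0 * suc k0) + 4 * p * suc k0) ∎
      where
      open ≤-Reasoning
      E T C : ℕ
      E = numEdges G
      T = sum (λ v → k0 ∸ d v)
      C = count lonely + count captive
      commute : ∀ a n → 4 * a * n ≡ 4 * (n * a)
      commute = solve-∀
      distribute : ∀ q e t p c → 4 * (q * (2 * e) + (q * t + p * c)) ≡ 8 * q * e + (q * (4 * t) + 4 * p * c)
      distribute = solve-∀

-- From ℕ to ℚ

-- ⟦ m ⟧ unfolds to fromℚᵘ ⟦ m ⟧ᵘ, so ⟦_⟧ is analysed through ℚᵘ.
⟦_⟧ᵘ : ℕ → ℚᵘ
⟦ m ⟧ᵘ = mkℚᵘ (ℤ.+ m) 0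

toℚᵘ-⟦⟧ : ∀ m → ℚ.toℚᵘ ⟦ m ⟧ ℚᵘ.≃ ⟦ m ⟧ᵘ
toℚᵘ-⟦⟧ m = ℚₚ.toℚᵘ-fromℚᵘ ⟦ m ⟧ᵘ

⟦⟧-via-ℚᵘ : ∀ {m : ℕ} {x : ℚ} → ⟦ m ⟧ᵘ ℚᵘ.≃ ℚ.toℚᵘ x → ⟦ m ⟧ ≡ x
⟦⟧-via-ℚᵘ {m} e = ℚₚ.toℚᵘ-injective (ℚᵘₚ.≃-trans (toℚᵘ-⟦⟧ m) e)

⟦⟧-homo-+ : ∀ a b → ⟦ a + b ⟧ ≡ ⟦ a ⟧ ℚ.+ ⟦ b ⟧
⟦⟧-homo-+ a b = ⟦⟧-via-ℚᵘ (begin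
  ⟦ a + b ⟧ᵘ                      ≈⟨ *≡* (trans (cong (ℤ._* ℤ.+ 1) (ℤₚ.pos-+ a b))
                                           (unit-denominators (ℤ.+ a) (ℤ.+ b))) ⟩
  ⟦ a ⟧ᵘ ℚᵘ.+ ⟦ b ⟧ᵘ              ≈⟨ ℚᵘₚ.+-cong (ℚᵘₚ.≃-sym (toℚᵘ-⟦⟧ a)) (ℚᵘₚ.≃-sym (toℚᵘ-⟦⟧ b)) ⟩
  ℚ.toℚᵘ ⟦ a ⟧ ℚᵘ.+ ℚ.toℚᵘ ⟦ b ⟧  ≈⟨ ℚᵘₚ.≃-sym (ℚₚ.toℚᵘ-homo-+ ⟦ a ⟧ ⟦ b ⟧) ⟩
  ℚ.toℚᵘ (⟦ a ⟧ ℚ.+ ⟦ b ⟧)        ∎)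
  where
  open ℚᵘₚ.≃-Reasoning
  unit-denominators : ∀ x y → (x ℤ.+ y) ℤ.* ℤ.+ 1 ≡ (x ℤ.* ℤ.+ 1 ℤ.+ y ℤ.* ℤ.+ 1) ℤ.* ℤ.+ 1
  unit-denominators x y = trans (ℤₚ.*-identityʳ (x ℤ.+ y))
    (≡.sym (trans (ℤₚ.*-identityʳ _) (cong₂ ℤ._+_ (ℤₚ.*-identityʳ x) (ℤₚ.*-identityʳ y))))

⟦⟧-homo-* : ∀ a b → ⟦ a * b ⟧ ≡ ⟦ a ⟧ ℚ.* ⟦ b ⟧
⟦⟧-homo-* a b = ⟦⟧-via-ℚᵘ (begin
  ⟦ a * b ⟧ᵘ                      ≈⟨ *≡* (cong (ℤ._* ℤ.+ 1) (ℤₚ.pos-* a b)) ⟩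
  ⟦ a ⟧ᵘ ℚᵘ.* ⟦ b ⟧ᵘ              ≈⟨ ℚᵘₚ.*-cong (ℚᵘₚ.≃-sym (toℚᵘ-⟦⟧ a)) (ℚᵘₚ.≃-sym (toℚᵘ-⟦⟧ b)) ⟩
  ℚ.toℚᵘ ⟦ a ⟧ ℚᵘ.* ℚ.toℚᵘ ⟦ b ⟧  ≈⟨ ℚᵘₚ.≃-sym (ℚₚ.toℚᵘ-homo-* ⟦ a ⟧ ⟦ b ⟧) ⟩
  ℚ.toℚᵘ (⟦ a ⟧ ℚ.* ⟦ b ⟧)        ∎)
  where open ℚᵘₚ.≃-Reasoning

⟦⟧-homo-∸ : ∀ {a b} → b ≤ a → ⟦ a ∸ b ⟧ ≡ ⟦ a ⟧ ℚ.- ⟦ b ⟧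
⟦⟧-homo-∸ {a} {b} b≤a = begin
  ⟦ a ∸ b ⟧                      ≡⟨ solve 2 (λ x y → x := y :+ x :- y) refl ⟦ a ∸ b ⟧ ⟦ b ⟧ ⟩
  ⟦ b ⟧ ℚ.+ ⟦ a ∸ b ⟧ ℚ.- ⟦ b ⟧  ≡⟨ cong (ℚ._- ⟦ b ⟧) (≡.sym (⟦⟧-homo-+ b (a ∸ b))) ⟩
  ⟦ b + (a ∸ b) ⟧ ℚ.- ⟦ b ⟧      ≡⟨ cong (λ m → ⟦ m ⟧ ℚ.- ⟦ b ⟧) (m+[n∸m]≡n b≤a) ⟩
  ⟦ a ⟧ ℚ.- ⟦ b ⟧                ∎
  where
  open ≡-Reasoning
  open ℚ-Solver.+-*-Solver using (solve; _:+_; _:-_; _:=_)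

⟦⟧-mono-≤ : ∀ {a b} → a ≤ b → ⟦ a ⟧ ≤ℚ ⟦ b ⟧
⟦⟧-mono-≤ {a} {b} a≤b = ℚₚ.toℚᵘ-cancel-≤
  (ℚᵘₚ.≤-respˡ-≃ (ℚᵘₚ.≃-sym (toℚᵘ-⟦⟧ a)) (ℚᵘₚ.≤-respʳ-≃ (ℚᵘₚ.≃-sym (toℚᵘ-⟦⟧ b))
    (*≤* (subst₂ ℤ._≤_ (≡.sym (ℤₚ.*-identityʳ (ℤ.+ a))) (≡.sym (ℤₚ.*-identityʳ (ℤ.+ b)))
                      (ℤ.+≤+ a≤b)))))

⟦⟧-cancel-≤ : ∀ {a b} → ⟦ a ⟧ ≤ℚ ⟦ b ⟧ → a ≤ b
⟦⟧-cancel-≤ {a} {b} ⟦a⟧≤⟦b⟧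
  with ℚᵘₚ.≤-respˡ-≃ (toℚᵘ-⟦⟧ a) (ℚᵘₚ.≤-respʳ-≃ (toℚᵘ-⟦⟧ b) (ℚₚ.toℚᵘ-mono-≤ ⟦a⟧≤⟦b⟧))
... | *≤* a*1≤b*1 = ℤₚ.drop‿+≤+ (subst₂ ℤ._≤_ (ℤₚ.*-identityʳ (ℤ.+ a)) (ℤₚ.*-identityʳ (ℤ.+ b)) a*1≤b*1)

⟦suc⟧-positive : ∀ d → ℚ.Positive ⟦ suc d ⟧
⟦suc⟧-positive d = ℚₚ.normalize-pos (suc d) 1

÷ℕ-cancel : ∀ x d → (x ÷ℕ suc d) ℚ.* ⟦ suc d ⟧ ≡ x
÷ℕ-cancel x d = begin
  x ℚ.* (ℤ.+ 1 ℚ./ suc d) ℚ.* ⟦ suc d ⟧    ≡⟨ ℚₚ.*-assoc x _ _ ⟩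
  x ℚ.* ((ℤ.+ 1 ℚ./ suc d) ℚ.* ⟦ suc d ⟧)  ≡⟨ cong (x ℚ.*_) 1/d*d≡1 ⟩
  x ℚ.* ℚ.1ℚ                             ≡⟨ ℚₚ.*-identityʳ x ⟩
  x                                      ∎
  where
  open ≡-Reasoning
  1/d*d≡1 : (ℤ.+ 1 ℚ./ suc d) ℚ.* ⟦ suc d ⟧ ≡ ℚ.1ℚ
  1/d*d≡1 = ℚₚ.toℚᵘ-injective (ℚᵘₚ.≃-trans (ℚₚ.toℚᵘ-homo-* (ℤ.+ 1 ℚ./ suc d) ⟦ suc d ⟧)
    (ℚᵘₚ.≃-trans (ℚᵘₚ.*-cong (ℚₚ.toℚᵘ-fromℚᵘ (mkℚᵘ (ℤ.+ 1) d)) (toℚᵘ-⟦⟧ (suc d)))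
      (*≡* (trans (ℤₚ.*-identityʳ (ℤ.+ 1 ℤ.* ℤ.+ suc d)) (trans (ℤₚ.*-identityˡ (ℤ.+ suc d))
             (trans (cong (λ m → ℤ.+ suc m) (≡.sym (*-identityʳ d))) (≡.sym (ℤₚ.*-identityˡ _))))))))

-- Multiplying the left-hand side by 8·(q + 1) turns the claim into the given inequality in ℕ.
≤-clear-denominators : ∀ (q p k n e s s′ : ℕ) {P S S′ a b c g : ℚ} →
  ⟦ p ⟧ ≡ P → ⟦ s ⟧ ≡ S → ⟦ s′ ⟧ ≡ S′ →
  a ℚ.* ⟦ suc q ⟧ ≡ P → b ℚ.* ⟦ 2 ⟧ ≡ ⟦ n ⟧ →
  c ℚ.* ⟦ 2 * suc q ⟧ ≡ S′ ℚ.* P → g ℚ.* ⟦ 8 ⟧ ≡ S ℚ.* S →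
  4 * (suc q * k + p) * n ≤ 8 * suc q * e + (suc q * (s * s) + 4 * p * s′) →
  (⟦ k ⟧ ℚ.+ a) ℚ.* b ℚ.- (c ℚ.+ g) ≤ℚ ⟦ e ⟧
≤-clear-denominators q p k n e s s′ {P} {S} {S′} {a} {b} {c} {g} ⟦p⟧ ⟦s⟧ ⟦s′⟧ aQ b2 c2Q g8 ineq =
  ℚₚ.*-cancelʳ-≤-pos M {{M-positive}} (begin
    ((K ℚ.+ a) ℚ.* b ℚ.- (c ℚ.+ g)) ℚ.* M
      ≡⟨ expand K a b c g Q ⟩
    ⟦ 4 ⟧ ℚ.* (Q ℚ.* K ℚ.+ a ℚ.* Q) ℚ.* (b ℚ.* ⟦ 2 ⟧) ℚ.- (Q ℚ.* (g ℚ.* ⟦ 8 ⟧) ℚ.+ ⟦ 4 ⟧ ℚ.* (c ℚ.* (⟦ 2 ⟧ ℚ.* Q)))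
      ≡⟨ cong₂ ℚ._-_ (cong₂ (λ x y → ⟦ 4 ⟧ ℚ.* (Q ℚ.* K ℚ.+ x) ℚ.* y) aQ b2)
                     (cong₂ (λ x y → Q ℚ.* x ℚ.+ ⟦ 4 ⟧ ℚ.* y) g8
                            (trans (cong (c ℚ.*_) (≡.sym (⟦⟧-homo-* 2 (suc q)))) c2Q)) ⟩
    X ℚ.- Z        ≤⟨ ℚₚ.+-monoˡ-≤ (ℚ.- Z) ineqℚ ⟩
    Y ℚ.+ Z′ ℚ.- Z ≡⟨ collapse ⟦ 8 ⟧ Q E (S ℚ.* S) ⟦ 4 ⟧ P S′ ⟩
    E ℚ.* M        ∎)
  where
  open ℚₚ.≤-Reasoning
  open ℚ-Solver.+-*-Solver using (solve; _:+_; _:-_; _:*_; _:=_; con)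
  K N E Q M X Y Z Z′ : ℚ
  K = ⟦ k ⟧ ; N = ⟦ n ⟧ ; E = ⟦ e ⟧ ; Q = ⟦ suc q ⟧
  M = ⟦ 8 ⟧ ℚ.* Q
  X = ⟦ 4 ⟧ ℚ.* (Q ℚ.* K ℚ.+ P) ℚ.* N
  Y = ⟦ 8 ⟧ ℚ.* Q ℚ.* E
  Z = Q ℚ.* (S ℚ.* S) ℚ.+ ⟦ 4 ⟧ ℚ.* (S′ ℚ.* P)
  Z′ = Q ℚ.* (S ℚ.* S) ℚ.+ ⟦ 4 ⟧ ℚ.* P ℚ.* S′
  M-positive : ℚ.Positive M
  M-positive = ℚₚ.pos*pos⇒pos ⟦ 8 ⟧ {{⟦suc⟧-positive 7}} Q {{⟦suc⟧-positive q}}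
  expand : ∀ K a b c g Q → ((K ℚ.+ a) ℚ.* b ℚ.- (c ℚ.+ g)) ℚ.* (⟦ 8 ⟧ ℚ.* Q) ≡
    ⟦ 4 ⟧ ℚ.* (Q ℚ.* K ℚ.+ a ℚ.* Q) ℚ.* (b ℚ.* ⟦ 2 ⟧) ℚ.- (Q ℚ.* (g ℚ.* ⟦ 8 ⟧) ℚ.+ ⟦ 4 ⟧ ℚ.* (c ℚ.* (⟦ 2 ⟧ ℚ.* Q)))
  expand = solve 6 (λ K a b c g Q →
    ((K :+ a) :* b :- (c :+ g)) :* (con ⟦ 8 ⟧ :* Q) :=
    con ⟦ 4 ⟧ :* (Q :* K :+ a :* Q) :* (b :* con ⟦ 2 ⟧) :-
      (Q :* (g :* con ⟦ 8 ⟧) :+ con ⟦ 4 ⟧ :* (c :* (con ⟦ 2 ⟧ :* Q)))) refl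
  collapse : ∀ e8 Q E SS e4 P S′ →
    e8 ℚ.* Q ℚ.* E ℚ.+ (Q ℚ.* SS ℚ.+ e4 ℚ.* P ℚ.* S′) ℚ.- (Q ℚ.* SS ℚ.+ e4 ℚ.* (S′ ℚ.* P)) ≡ E ℚ.* (e8 ℚ.* Q)
  collapse = solve 7 (λ e8 Q E SS e4 P S′ →
    e8 :* Q :* E :+ (Q :* SS :+ e4 :* P :* S′) :- (Q :* SS :+ e4 :* (S′ :* P)) := E :* (e8 :* Q)) refl
  ineqℚ : X ≤ℚ Y ℚ.+ Z′
  ineqℚ = subst₂ _≤ℚ_ lhs rhs (⟦⟧-mono-≤ ineq)
    where
    lhs : ⟦ 4 * (suc q * k + p) * n ⟧ ≡ X
    lhs = trans (⟦⟧-homo-* (4 * (suc q * k + p)) n) (cong (ℚ._* N)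
            (trans (⟦⟧-homo-* 4 (suc q * k + p)) (cong (⟦ 4 ⟧ ℚ.*_)
              (trans (⟦⟧-homo-+ (suc q * k) p) (cong₂ ℚ._+_ (⟦⟧-homo-* (suc q) k) ⟦p⟧)))))
    rhs : ⟦ 8 * suc q * e + (suc q * (s * s) + 4 * p * s′) ⟧ ≡ Y ℚ.+ Z′
    rhs = trans (⟦⟧-homo-+ (8 * suc q * e) (suc q * (s * s) + 4 * p * s′)) (cong₂ ℚ._+_
            (trans (⟦⟧-homo-* (8 * suc q) e) (cong (ℚ._* E) (⟦⟧-homo-* 8 (suc q))))
            (trans (⟦⟧-homo-+ (suc q * (s * s)) (4 * p * s′)) (cong₂ ℚ._+_
              (trans (⟦⟧-homo-* (suc q) (s * s)) (cong (Q ℚ.*_) (trans (⟦⟧-homo-* s s) (cong₂ ℚ._*_ ⟦s⟧ ⟦s⟧))))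
              (trans (⟦⟧-homo-* (4 * p) s′) (cong₂ ℚ._*_ (trans (⟦⟧-homo-* 4 p) (cong (⟦ 4 ⟧ ℚ.*_) ⟦p⟧)) ⟦s′⟧)))))

module _ (k0 k0' k1' n : ℕ) where
  open Bound k0 k0' k1' n

  scaled-threshold : threshold ℚ.* ⟦ suc k0 ⟧ ℚ.+ K0 ≡ ⟦ k1' * suc k0 + k0' ⟧
  scaled-threshold = begin
    (K1' ℚ.+ (K0' ℚ.- K0) ÷ℕ (k0 + 1)) ℚ.* ⟦ suc k0 ⟧ ℚ.+ K0
      ≡⟨ cong (λ d → (K1' ℚ.+ (K0' ℚ.- K0) ÷ℕ d) ℚ.* ⟦ suc k0 ⟧ ℚ.+ K0) (+-comm k0 1) ⟩
    (K1' ℚ.+ (K0' ℚ.- K0) ÷ℕ suc k0) ℚ.* ⟦ suc k0 ⟧ ℚ.+ K0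
      ≡⟨ cong (ℚ._+ K0) (ℚₚ.*-distribʳ-+ ⟦ suc k0 ⟧ K1' _) ⟩
    K1' ℚ.* ⟦ suc k0 ⟧ ℚ.+ (K0' ℚ.- K0) ÷ℕ suc k0 ℚ.* ⟦ suc k0 ⟧ ℚ.+ K0
      ≡⟨ cong (λ x → K1' ℚ.* ⟦ suc k0 ⟧ ℚ.+ x ℚ.+ K0) (÷ℕ-cancel (K0' ℚ.- K0) k0) ⟩
    K1' ℚ.* ⟦ suc k0 ⟧ ℚ.+ (K0' ℚ.- K0) ℚ.+ K0
      ≡⟨ solve 3 (λ a b c → a :+ (b :- c) :+ c := a :+ b) refl (K1' ℚ.* ⟦ suc k0 ⟧) K0' K0 ⟩
    K1' ℚ.* ⟦ suc k0 ⟧ ℚ.+ K0'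
      ≡⟨ ≡.sym (trans (⟦⟧-homo-+ (k1' * suc k0) k0') (cong (ℚ._+ K0') (⟦⟧-homo-* k1' (suc k0)))) ⟩
    ⟦ k1' * suc k0 + k0' ⟧ ∎
    where
    open ≡-Reasoning
    open ℚ-Solver.+-*-Solver using (solve; _:+_; _:-_; _:=_)

  scaled-K0' : K0' ℚ.* ⟦ suc k0 ⟧ ℚ.+ K0 ≡ ⟦ k0' * suc k0 + k0 ⟧
  scaled-K0' = ≡.sym (trans (⟦⟧-homo-+ (k0' * suc k0) k0) (cong (ℚ._+ K0) (⟦⟧-homo-* k0' (suc k0))))

  scale-≤ : ∀ {x y} → x ≤ℚ y → x ℚ.* ⟦ suc k0 ⟧ ℚ.+ K0 ≤ℚ y ℚ.* ⟦ suc k0 ⟧ ℚ.+ K0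
  scale-≤ x≤y = ℚₚ.+-monoˡ-≤ K0 (ℚₚ.*-monoʳ-≤-nonNeg ⟦ suc k0 ⟧ {{ℚₚ.pos⇒nonNeg ⟦ suc k0 ⟧ {{⟦suc⟧-positive k0}}}} x≤y)

  below-threshold : K0' ≤ℚ threshold → k0' * suc k0 + k0 ≤ k1' * suc k0 + k0'
  below-threshold le = ⟦⟧-cancel-≤ (subst₂ _≤ℚ_ scaled-K0' scaled-threshold (scale-≤ le))

  above-threshold : threshold ≤ℚ K0' → k1' * suc k0 + k0' ≤ k0' * suc k0 + k0
  above-threshold le = ⟦⟧-cancel-≤ (subst₂ _≤ℚ_ scaled-threshold scaled-K0' (scale-≤ le))

⟦suc⟧ : ∀ k → ⟦ suc k ⟧ ≡ ⟦ k ⟧ ℚ.+ ⟦ 1 ⟧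
⟦suc⟧ k = trans (cong ⟦_⟧ (+-comm 1 k)) (⟦⟧-homo-+ k 1)

⟦suc-suc⟧ : ∀ k → ⟦ suc (suc k) ⟧ ≡ ⟦ k ⟧ ℚ.+ ⟦ 2 ⟧
⟦suc-suc⟧ k = trans (cong ⟦_⟧ (+-comm 2 k)) (⟦⟧-homo-+ k 2)

bound1≤ : ∀ {k0 k0' k1' n e} → k0 ≤ k0' →
  4 * (suc k0' * k0 + (k0' ∸ k0)) * n ≤ 8 * suc k0' * e + (suc k0' * (suc k0 * suc k0) + 4 * (k0' ∸ k0) * suc k0) →
  Bound.bound1 k0 k0' k1' n ≤ℚ ⟦ e ⟧
bound1≤ {k0} {k0'} {k1'} {n} {e} k0≤k0' =
  ≤-clear-denominators k0' (k0' ∸ k0) k0 n e (suc k0) (suc k0)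
    {a = (K0' ℚ.- K0) ÷ℕ (k0' + 1)} {N ÷ℕ 2} {X ÷ℕ (2 * k0' + 2)} {Y ÷ℕ 8}
    (⟦⟧-homo-∸ k0≤k0') (⟦suc⟧ k0) (⟦suc⟧ k0)
    (trans (cong (λ d → (K0' ℚ.- K0) ÷ℕ d ℚ.* ⟦ suc k0' ⟧) (+-comm k0' 1)) (÷ℕ-cancel (K0' ℚ.- K0) k0'))
    (÷ℕ-cancel N 1)
    (trans (cong (λ d → X ÷ℕ d ℚ.* ⟦ 2 * suc k0' ⟧) (trans (+-comm (2 * k0') 2) (≡.sym (*-suc 2 k0'))))
           (÷ℕ-cancel X (k0' + suc (k0' + 0))))
    (÷ℕ-cancel Y 7)
  where
  open Bound k0 k0' k1' n
  X Y : ℚ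
  X = (K0 ℚ.+ ⟦ 1 ⟧) ℚ.* (K0' ℚ.- K0)
  Y = (K0 ℚ.+ ⟦ 1 ⟧) ℚ.* (K0 ℚ.+ ⟦ 1 ⟧)

bound2≤ : ∀ {k0 k0' k1' n e} → k0 < k1' →
  4 * (k1' * k0 + (k1' ∸ k0)) * n ≤ 8 * k1' * e + (k1' * (suc k0 * suc k0) + 4 * (k1' ∸ k0) * suc k0) →
  Bound.bound2 k0 k0' k1' n ≤ℚ ⟦ e ⟧
bound2≤ {k0} {k0'} {suc m} {n} {e} k0<k1' core =
  ≤-clear-denominators m (suc m ∸ k0) k0 n e (suc k0) (suc (suc k0))
    {a = (K1' ℚ.- K0) ÷ℕ suc m} {N ÷ℕ 2} {X ÷ℕ (2 * suc m)} {Y ÷ℕ 8}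
    (⟦⟧-homo-∸ (<⇒≤ k0<k1')) (⟦suc⟧ k0) (⟦suc-suc⟧ k0)
    (÷ℕ-cancel (K1' ℚ.- K0) m) (÷ℕ-cancel N 1) (÷ℕ-cancel X (m + suc (m + 0))) (÷ℕ-cancel Y 7)
    (≤-trans core (+-monoʳ-≤ (8 * suc m * e) (+-monoʳ-≤ (suc m * (suc k0 * suc k0))
                                                         (*-monoʳ-≤ (4 * (suc m ∸ k0)) (n≤1+n (suc k0))))))
  where
  open Bound k0 k0' (suc m) n
  X Y : ℚ
  X = (K0 ℚ.+ ⟦ 2 ⟧) ℚ.* (K1' ℚ.- K0)
  Y = (K0 ℚ.+ ⟦ 1 ⟧) ℚ.* (K0 ℚ.+ ⟦ 1 ⟧)

x+a≡y+b∧b≤a⇒x≤y : ∀ {x y a b} → x + a ≡ y + b → b ≤ a → x ≤ y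
x+a≡y+b∧b≤a⇒x≤y {x} {y} {a} {b} e b≤a = +-cancelʳ-≤ a x y (subst (_≤ y + a) (≡.sym e) (+-monoʳ-≤ y b≤a))

case₁-affordable-k0' : ∀ k0 r {k0'} → k0 + r ≡ k0' → suc k0' * k0 + r * suc k0' ≤ suc k0' * k0'
case₁-affordable-k0' k0 r refl = ≤-reflexive (identity k0 r)
  where
  identity : ∀ k r → suc (k + r) * k + r * suc (k + r) ≡ suc (k + r) * (k + r)
  identity = solve-∀

case₁-affordable-k1' : ∀ k0 r {k0' k1'} → k0 + r ≡ k0' → k0' * suc k0 + k0 ≤ k1' * suc k0 + k0' →
  suc k0' * k0 + r * k1' ≤ suc k0' * k1'
case₁-affordable-k1' k0 r {k1' = k1'} refl = x+a≡y+b∧b≤a⇒x≤y (identity k0 r k1')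
  where
  identity : ∀ k r l → suc (k + r) * k + r * l + (l * suc k + (k + r)) ≡ suc (k + r) * l + ((k + r) * suc k + k)
  identity = solve-∀

case₂-affordable-k1' : ∀ k0 r {k1'} → k0 + r ≡ k1' → k1' * k0 + r * k1' ≤ k1' * k1'
case₂-affordable-k1' k0 r refl = ≤-reflexive (identity k0 r)
  where
  identity : ∀ k r → (k + r) * k + r * (k + r) ≡ (k + r) * (k + r)
  identity = solve-∀

case₂-affordable-k0' : ∀ k0 r {k1' k0'} → k0 + r ≡ k1' → k1' * suc k0 + k0' ≤ k0' * suc k0 + k0 →
  k1' * k0 + r * suc k0' ≤ k1' * k0'
case₂-affordable-k0' k0 r {k0' = k0'} refl = x+a≡y+b∧b≤a⇒x≤y (identity k0 r k0')
  where
  identity : ∀ k r o → (k + r) * k + r * suc o + (o * suc k + k) ≡ (k + r) * o + ((k + r) * suc k + o)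
  identity = solve-∀

lemma2p7 : ∀ {h} (H : Graph h) → HasEdge H → NoIsolatedEdges H →
    ∀ (k0 k1 k0' k1' : ℕ) → IsK0 H k0 → IsK1 H k1 → IsK0' H k1 k0' → IsK1' H k0 k1' →
    k0 ≡ k1 → k1 < k1' → k1' < k0' →
    ∀ (n : ℕ) → h ≤ n → ∀ (G : Graph n) → Saturated H G →
      (⟦ k0' ⟧ ≤ℚ Bound.threshold k0 k0' k1' n →
         Bound.bound1 k0 k0' k1' n ≤ℚ ⟦ numEdges G ⟧) ×
      (Bound.threshold k0 k0' k1' n ≤ℚ ⟦ k0' ⟧ →
         Bound.bound2 k0 k0' k1' n ≤ℚ ⟦ numEdges G ⟧)
lemma2p7 H _ _ k0 _ k0' k1' isK0 isK1 isK0' isK1' refl k0<k1' k1'<k0' n _ G sat = below , above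
  where
  open Structure {H = H} {G} sat k0<k1' k1'<k0'
    (λ uv → proj₂ isK0 _ _ uv tt) (λ uv → proj₂ isK1 _ _ uv tt) (proj₂ isK0' _ _) (proj₂ isK1' _ _)
  k0≤k0' : k0 ≤ k0'
  k0≤k0' = <⇒≤ (<-trans k0<k1' k1'<k0')
  k0≤k1' : k0 ≤ k1'
  k0≤k1' = <⇒≤ k0<k1'

  below : ⟦ k0' ⟧ ≤ℚ Bound.threshold k0 k0' k1' n → Bound.bound1 k0 k0' k1' n ≤ℚ ⟦ numEdges G ⟧
  below le = bound1≤ {k1' = k1'} {n} k0≤k0' (Discharge.core (≤-trans (m∸n≤m k0' k0) (n≤1+n k0'))
    (case₁-affordable-k0' k0 (k0' ∸ k0) (m+[n∸m]≡n k0≤k0'))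
    (case₁-affordable-k1' k0 (k0' ∸ k0) (m+[n∸m]≡n k0≤k0') (below-threshold k0 k0' k1' n le)))

  above : Bound.threshold k0 k0' k1' n ≤ℚ ⟦ k0' ⟧ → Bound.bound2 k0 k0' k1' n ≤ℚ ⟦ numEdges G ⟧
  above le = bound2≤ {k0' = k0'} {n = n} k0<k1' (Discharge.core (m∸n≤m k1' k0)
    (case₂-affordable-k0' k0 (k1' ∸ k0) (m+[n∸m]≡n k0≤k1') (above-threshold k0 k0' k1' n le))
    (case₂-affordable-k1' k0 (k1' ∸ k0) (m+[n∸m]≡n k0≤k1')))
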